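{- Let $q$ be even and let $X$ be a generalized quadratic set of type (SC) of the hyperbolic quadric $Q^+(5,q)$. Let $A_1$ be the set of points of $X$ contained in some plane of $Q^+(5,q)$ of type (S) with respect to $X$, and $A_2$ the set of kernels of the ovals $\pi\cap X$ where $\pi$ ranges over the planes of $Q^+(5,q)$ of type (C). Suppose (1) every plane of $Q^+(5,q)$ through a point of $A_1$ has type (S), and (2) every plane $\pi$ of $Q^+(5,q)$ through a point $x\in A_2$ has type (C) and $x$ is the kernel of the oval $\pi\cap X$. Then no two distinct points of $A_1\cup A_2$ are collinear in $Q^+(5,q)$ (i.e. joined by a line contained in $Q^+(5,q)$).
   Context: A generalized quadratic set of type (SC) of $Q^+(5,q)$ is a set $X$ of points of $Q^+(5,q)$ such that every plane contained in $Q^+(5,q)$ meets $X$ in either a single point (type (S)) or an oval of the plane (type (C)), with both types occurring. An oval of a projective plane of order $q$ is a set of $q+1$ points no three collinear; for $q$ even its tangent lines are concurrent in a point called its kernel. -}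

module Defs where

open import Level using (0ℓ)
open import Data.Nat using (ℕ; suc)
open import Data.Fin using (Fin; zero; suc)
open import Data.Product using (Σ; ∃; _×_; _,_)
open import Data.Sum using (_⊎_)
open import Relation.Nullary using (¬_)
open import Relation.Binary.PropositionalEquality using (_≡_)
open import Algebra.Bundles using (CommutativeRing)

record IsField (R : CommutativeRing 0ℓ 0ℓ) : Set where
  open CommutativeRing R
  field
    1≉0     : ¬ (1# ≈ 0#)
    inverse : ∀ x → ¬ (x ≈ 0#) → ∃ λ y → x * y ≈ 1#

record HasOrder (R : CommutativeRing 0ℓ 0ℓ) (q : ℕ) : Set where
  open CommutativeRing R
  field
    enum       : Fin q → Carrier
    injective  : ∀ i j → enum i ≈ enum j → i ≡ j
    surjective : ∀ x → ∃ λ i → enum i ≈ x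

module Geometry (R : CommutativeRing 0ℓ 0ℓ) where
  open CommutativeRing R using (Carrier; _≈_; _+_; _*_; 0#; 1#)

  Vec6 : Set
  Vec6 = Fin 6 → Carrier

  _≈v_ : Vec6 → Vec6 → Set
  u ≈v v = ∀ i → u i ≈ v i

  zeroV : Vec6
  zeroV _ = 0#

  _·_ : Carrier → Vec6 → Vec6
  (a · v) i = a * v i

  _⊕_ : Vec6 → Vec6 → Vec6
  (u ⊕ v) i = u i + v i

  -- a projective point is represented by a nonzero vector
  NonZero : Vec6 → Set
  NonZero v = ¬ (v ≈v zeroV)

  _∼_ : Vec6 → Vec6 → Set
  u ∼ v = ∃ λ a → ¬ (a ≈ 0#) × (u ≈v (a · v))

  Q : Vec6 → Carrier
  Q v = (v zero * v (suc zero))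
      + ((v (suc (suc zero)) * v (suc (suc (suc zero))))
      + (v (suc (suc (suc (suc zero)))) * v (suc (suc (suc (suc (suc zero)))))))

  OnQuadric : Vec6 → Set
  OnQuadric v = NonZero v × (Q v ≈ 0#)

  Independent2 : Vec6 → Vec6 → Set
  Independent2 u v = ∀ a b → ((a · u) ⊕ (b · v)) ≈v zeroV → (a ≈ 0#) × (b ≈ 0#)

  Independent3 : Vec6 → Vec6 → Vec6 → Set
  Independent3 u v w = ∀ a b c → (((a · u) ⊕ (b · v)) ⊕ (c · w)) ≈v zeroV
                         → (a ≈ 0#) × (b ≈ 0#) × (c ≈ 0#)

  LineOnQuadric : Vec6 → Vec6 → Set
  LineOnQuadric u v = Independent2 u v × (∀ a b → Q ((a · u) ⊕ (b · v)) ≈ 0#)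

  OnLine : Vec6 → Vec6 → Vec6 → Set
  OnLine u v x = ∃ λ a → ∃ λ b → x ≈v ((a · u) ⊕ (b · v))

  CollinearInQuadric : Vec6 → Vec6 → Set
  CollinearInQuadric x y = LineOnQuadric x y

  record Plane : Set where
    constructor plane
    field
      b₁ b₂ b₃    : Vec6
      independent : Independent3 b₁ b₂ b₃

  open Plane public

  InPlane : Plane → Vec6 → Set
  InPlane π x = NonZero x ×
    (∃ λ a → ∃ λ b → ∃ λ c → x ≈v (((a · b₁ π) ⊕ (b · b₂ π)) ⊕ (c · b₃ π)))

  PlaneOfQuadric : Plane → Set
  PlaneOfQuadric π = ∀ a b c → Q (((a · b₁ π) ⊕ (b · b₂ π)) ⊕ (c · b₃ π)) ≈ 0#

  _∩_ : Plane → (Vec6 → Set) → Vec6 → Set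
  (π ∩ X) x = InPlane π x × X x

  SinglePoint : (Vec6 → Set) → Set
  SinglePoint S = ∃ λ p → S p × (∀ x → S x → x ∼ p)

  IsOval : ℕ → Plane → (Vec6 → Set) → Set
  IsOval q π S =
    (∀ x → S x → InPlane π x) ×
    (Σ (Fin (suc q) → Vec6) λ f →
       (∀ i → S (f i)) ×
       (∀ i j → f i ∼ f j → i ≡ j) ×
       (∀ x → S x → ∃ λ i → x ∼ f i)) ×
    (∀ x y z → S x → S y → S z → ¬ (x ∼ y) → ¬ (x ∼ z) → ¬ (y ∼ z)
       → Independent3 x y z)

  -- n is the kernel of the oval S of π: n is a point of π off S and, for
  -- every point p of S, the line pn is the tangent line at p (it meets S only in p),
  -- i.e. n is the common point of the tangent lines of S.
  IsKernel : Plane → (Vec6 → Set) → Vec6 → Set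
  IsKernel π S n =
    InPlane π n × ¬ (S n) ×
    (∀ p → S p → ∀ r → S r → OnLine p n r → r ∼ p)

  TypeS : (Vec6 → Set) → Plane → Set
  TypeS X π = SinglePoint (π ∩ X)

  TypeC : ℕ → (Vec6 → Set) → Plane → Set
  TypeC q X π = IsOval q π (π ∩ X)

  PointSetOfQuadric : (Vec6 → Set) → Set
  PointSetOfQuadric X = (∀ x → X x → OnQuadric x) × (∀ x y → x ∼ y → X x → X y)

  GQSetSC : ℕ → (Vec6 → Set) → Set
  GQSetSC q X =
    PointSetOfQuadric X ×
    (∀ π → PlaneOfQuadric π → TypeS X π ⊎ TypeC q X π) ×
    (∃ λ π → PlaneOfQuadric π × TypeS X π) ×
    (∃ λ π → PlaneOfQuadric π × TypeC q X π)

  A₁ : (Vec6 → Set) → Vec6 → Set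
  A₁ X x = X x × (∃ λ π → PlaneOfQuadric π × TypeS X π × InPlane π x)

  A₂ : ℕ → (Vec6 → Set) → Vec6 → Set
  A₂ q X x = ∃ λ π → PlaneOfQuadric π × TypeC q X π × IsKernel π (π ∩ X) x

-- The line xy lies in a totally singular plane: x lies in a plane π of the
-- quadric, and π contains a point z, orthogonal to y and off the line xy, found in
-- coordinates with respect to a basis of π. In that plane the hypotheses leave three
-- cases: two points of A₁ make it of type (S) with x and y both equal to its single
-- point; a point of A₁ and a point of A₂ make it of type (S) and of type (C); two points
-- of A₂ make x and y two kernels of one oval. The last is impossible: projecting from an
-- oval point p off the line xy onto xy, the points x, y and the q other oval points have
-- q + 2 distinct images (px and py are tangents, the other lines through p are secants),
-- but a line has only q + 1 points.
module Submission where

open import Defs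
open import Level using (0ℓ)
open import Data.Nat as ℕ using (ℕ; zero; suc)
open import Data.Nat.Divisibility using (_∣_)
import Data.Nat.Properties as ℕ
open import Data.Fin as Fin using (Fin)
import Data.Fin.Properties as Fin
open import Data.Product using (Σ; ∃; _×_; _,_; proj₁; proj₂)
open import Data.Sum using (_⊎_; inj₁; inj₂)
open import Data.Empty using (⊥; ⊥-elim)
open import Relation.Nullary using (¬_; Dec; yes; no)
open import Relation.Nullary.Decidable using (¬¬-excluded-middle)
open import Relation.Binary.Definitions using (Decidable)
open import Relation.Binary.PropositionalEquality as ≡ using (_≡_; _≢_)
open import Algebra.Bundles using (CommutativeRing)

-- The ring solver with integer coefficients mapped into R, so that identities
-- involving subtraction can be normalised in an arbitrary commutative ring.
module IntegerCoefficients (R : CommutativeRing 0ℓ 0ℓ) where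
  open import Data.Integer as ℤ using (ℤ; +_; -[1+_]; _⊖_; sign; ∣_∣; _◃_)
  import Data.Integer.Properties as ℤ
  open import Data.Sign as Sign using (Sign)
  open import Data.Maybe using (Maybe; just; nothing)
  open import Algebra.Solver.Ring.AlmostCommutativeRing
  open CommutativeRing R
  open import Algebra.Properties.Semiring.Mult.TCOptimised semiring using (×-homo-+; ×1-homo-*)
    renaming (_×_ to _×ℕ_)
  open import Algebra.Properties.Ring ring
  open import Relation.Binary.Reasoning.Setoid setoid

  ⟦_⟧ℤ : ℤ → Carrier
  ⟦ + n ⟧ℤ      = n ×ℕ 1#
  ⟦ -[1+ n ] ⟧ℤ = - (suc n ×ℕ 1#)

  signed : Sign → Carrier → Carrier
  signed Sign.+ x = x
  signed Sign.- x = - x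

  signed-cong : ∀ s {x y} → x ≈ y → signed s x ≈ signed s y
  signed-cong Sign.+ x≈y = x≈y
  signed-cong Sign.- x≈y = -‿cong x≈y

  signed-* : ∀ s t x y → signed (s Sign.* t) (x * y) ≈ signed s x * signed t y
  signed-* Sign.+ Sign.+ x y = refl
  signed-* Sign.+ Sign.- x y = -‿distribʳ-* x y
  signed-* Sign.- Sign.+ x y = -‿distribˡ-* x y
  signed-* Sign.- Sign.- x y = begin
    x * y         ≈⟨ -‿involutive _ ⟨
    - - (x * y)   ≈⟨ -‿cong (-‿distribʳ-* x y) ⟩
    - (x * - y)   ≈⟨ -‿distribˡ-* x (- y) ⟩
    - x * - y     ∎

  ⟦⟧-signAbs : ∀ i → ⟦ i ⟧ℤ ≈ signed (sign i) (∣ i ∣ ×ℕ 1#)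
  ⟦⟧-signAbs -[1+ n ] = refl
  ⟦⟧-signAbs (+ n)    = refl

  ⟦⟧-◃ : ∀ s n → ⟦ s ◃ n ⟧ℤ ≈ signed s (n ×ℕ 1#)
  ⟦⟧-◃ Sign.+ zero    = refl
  ⟦⟧-◃ Sign.- zero    = sym -0#≈0#
  ⟦⟧-◃ Sign.+ (suc n) = refl
  ⟦⟧-◃ Sign.- (suc n) = refl

  ⟦⟧-neg : ∀ i → ⟦ ℤ.- i ⟧ℤ ≈ - ⟦ i ⟧ℤ
  ⟦⟧-neg -[1+ n ]    = sym (-‿involutive _)
  ⟦⟧-neg (+ zero)    = sym -0#≈0#
  ⟦⟧-neg (+ suc n)   = refl

  ⟦⟧-⊖ : ∀ m n → ⟦ m ⊖ n ⟧ℤ ≈ m ×ℕ 1# - n ×ℕ 1#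
  ⟦⟧-⊖ m n with ℕ.≤-<-connex n m
  ... | inj₁ n≤m = begin
    ⟦ m ⊖ n ⟧ℤ                                  ≡⟨ ≡.cong ⟦_⟧ℤ (ℤ.⊖-≥ n≤m) ⟩
    (m ℕ.∸ n) ×ℕ 1#                             ≈⟨ +-identityʳ _ ⟨
    (m ℕ.∸ n) ×ℕ 1# + 0#                        ≈⟨ +-congˡ (-‿inverseʳ _) ⟨
    (m ℕ.∸ n) ×ℕ 1# + (n ×ℕ 1# - n ×ℕ 1#)       ≈⟨ +-assoc _ _ _ ⟨
    ((m ℕ.∸ n) ×ℕ 1# + n ×ℕ 1#) - n ×ℕ 1#       ≈⟨ +-congʳ (×-homo-+ 1# (m ℕ.∸ n) n) ⟨
    ((m ℕ.∸ n) ℕ.+ n) ×ℕ 1# - n ×ℕ 1#           ≡⟨ ≡.cong (λ k → k ×ℕ 1# - n ×ℕ 1#) (ℕ.m∸n+n≡m n≤m) ⟩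
    m ×ℕ 1# - n ×ℕ 1#                           ∎
  ... | inj₂ m<n = begin
    ⟦ m ⊖ n ⟧ℤ                                  ≡⟨ ≡.cong ⟦_⟧ℤ (ℤ.⊖-< m<n) ⟩
    ⟦ ℤ.- (+ (n ℕ.∸ m)) ⟧ℤ                      ≈⟨ ⟦⟧-neg (+ (n ℕ.∸ m)) ⟩
    - ((n ℕ.∸ m) ×ℕ 1#)                         ≈⟨ +-identityˡ _ ⟨
    0# - (n ℕ.∸ m) ×ℕ 1#                        ≈⟨ +-congʳ (-‿inverseʳ _) ⟨
    (m ×ℕ 1# - m ×ℕ 1#) - (n ℕ.∸ m) ×ℕ 1#       ≈⟨ +-assoc _ _ _ ⟩
    m ×ℕ 1# + (- (m ×ℕ 1#) - (n ℕ.∸ m) ×ℕ 1#)   ≈⟨ +-congˡ (-‿+-comm _ _) ⟩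
    m ×ℕ 1# - (m ×ℕ 1# + (n ℕ.∸ m) ×ℕ 1#)       ≈⟨ +-congˡ (-‿cong (×-homo-+ 1# m (n ℕ.∸ m))) ⟨
    m ×ℕ 1# - (m ℕ.+ (n ℕ.∸ m)) ×ℕ 1#           ≡⟨ ≡.cong (λ k → m ×ℕ 1# - k ×ℕ 1#) (ℕ.m+[n∸m]≡n (ℕ.<⇒≤ m<n)) ⟩
    m ×ℕ 1# - n ×ℕ 1#                           ∎

  ⟦⟧-+ : ∀ i j → ⟦ i ℤ.+ j ⟧ℤ ≈ ⟦ i ⟧ℤ + ⟦ j ⟧ℤ
  ⟦⟧-+ -[1+ m ] -[1+ n ] = begin
    - (suc (suc (m ℕ.+ n)) ×ℕ 1#)   ≡⟨ ≡.cong (λ k → - (suc k ×ℕ 1#)) (ℕ.+-suc m n) ⟨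
    - ((suc m ℕ.+ suc n) ×ℕ 1#)     ≈⟨ -‿cong (×-homo-+ 1# (suc m) (suc n)) ⟩
    - (suc m ×ℕ 1# + suc n ×ℕ 1#)   ≈⟨ -‿+-comm _ _ ⟨
    - (suc m ×ℕ 1#) - suc n ×ℕ 1#   ∎
  ⟦⟧-+ -[1+ m ] (+ n)    = trans (⟦⟧-⊖ n (suc m)) (+-comm _ _)
  ⟦⟧-+ (+ m)    -[1+ n ] = ⟦⟧-⊖ m (suc n)
  ⟦⟧-+ (+ m)    (+ n)    = ×-homo-+ 1# m n

  ⟦⟧-* : ∀ i j → ⟦ i ℤ.* j ⟧ℤ ≈ ⟦ i ⟧ℤ * ⟦ j ⟧ℤ
  ⟦⟧-* i j = begin
    ⟦ (sign i Sign.* sign j) ◃ (∣ i ∣ ℕ.* ∣ j ∣) ⟧ℤ         ≈⟨ ⟦⟧-◃ (sign i Sign.* sign j) (∣ i ∣ ℕ.* ∣ j ∣) ⟩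
    signed (sign i Sign.* sign j) ((∣ i ∣ ℕ.* ∣ j ∣) ×ℕ 1#) ≈⟨ signed-cong (sign i Sign.* sign j) (×1-homo-* ∣ i ∣ ∣ j ∣) ⟩
    signed (sign i Sign.* sign j) (∣ i ∣ ×ℕ 1# * ∣ j ∣ ×ℕ 1#) ≈⟨ signed-* (sign i) (sign j) _ _ ⟩
    signed (sign i) (∣ i ∣ ×ℕ 1#) * signed (sign j) (∣ j ∣ ×ℕ 1#) ≈⟨ *-cong (⟦⟧-signAbs i) (⟦⟧-signAbs j) ⟨
    ⟦ i ⟧ℤ * ⟦ j ⟧ℤ                                          ∎

  ⟦⟧-homomorphism : ℤ.+-*-rawRing -Raw-AlmostCommutative⟶ fromCommutativeRing R
  ⟦⟧-homomorphism = record
    { ⟦_⟧    = ⟦_⟧ℤ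
    ; +-homo = ⟦⟧-+
    ; *-homo = ⟦⟧-*
    ; -‿homo = ⟦⟧-neg
    ; 0-homo = refl
    ; 1-homo = refl
    }

  ≡⇒⟦⟧≈ : ∀ i j → Maybe (⟦ i ⟧ℤ ≈ ⟦ j ⟧ℤ)
  ≡⇒⟦⟧≈ i j with i ℤ.≟ j
  ... | yes ≡.refl = just refl
  ... | no _       = nothing

  open import Algebra.Solver.Ring ℤ.+-*-rawRing (fromCommutativeRing R) ⟦⟧-homomorphism ≡⇒⟦⟧≈ public

  :0 :1 : ∀ {n} → Polynomial n
  :0 = con (+ 0)
  :1 = con (+ 1)

module _ {R : CommutativeRing 0ℓ 0ℓ} {q : ℕ} (H : HasOrder R q) where
  open CommutativeRing R
  open HasOrder H

  ≈-decidable : Decidable _≈_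
  ≈-decidable a b with proj₁ (surjective a) Fin.≟ proj₁ (surjective b)
  ... | yes i≡j = yes (trans (sym (proj₂ (surjective a)))
                        (trans (reflexive (≡.cong enum i≡j)) (proj₂ (surjective b))))
  ... | no  i≢j = no λ a≈b → i≢j (injective _ _
                        (trans (proj₂ (surjective a)) (trans a≈b (sym (proj₂ (surjective b))))))

¬HasOrder0 : ∀ {R} → ¬ HasOrder R 0
¬HasOrder0 {R} H = Fin.¬Fin0 (proj₁ (HasOrder.surjective H (CommutativeRing.0# R)))

module FieldGeometry (R : CommutativeRing 0ℓ 0ℓ) (F : IsField R)
                     (_≈?_ : Decidable (CommutativeRing._≈_ R)) where
  open CommutativeRing R hiding (zero)
  open IsField F
  open import Relation.Binary.Reasoning.Setoid setoid
  open IntegerCoefficients R using (Polynomial; solve; _:=_; _:+_; _:*_; _:-_; :-_; :0; :1)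
  open Geometry R

  ≈0-+ : ∀ {x y} → x ≈ 0# → y ≈ 0# → x + y ≈ 0#
  ≈0-+ x≈0 y≈0 = trans (+-cong x≈0 y≈0) (+-identityʳ 0#)

  ≈0-*ˡ : ∀ c {x} → x ≈ 0# → c * x ≈ 0#
  ≈0-*ˡ c x≈0 = trans (*-congˡ x≈0) (zeroʳ c)

  ≈0-*ʳ : ∀ {x} c → x ≈ 0# → x * c ≈ 0#
  ≈0-*ʳ c x≈0 = trans (*-congʳ x≈0) (zeroˡ c)

  ≈⇒-≈0 : ∀ {a b} → a ≈ b → a - b ≈ 0#
  ≈⇒-≈0 {b = b} a≈b = trans (+-congʳ a≈b) (-‿inverseʳ b)

  -- Most equations below are proved by exhibiting l - r as a ring-theoretic
  -- combination e of quantities already known to vanish.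
  ≈-by-certificate : ∀ {l r e} → l - r ≈ e → e ≈ 0# → l ≈ r
  ≈-by-certificate {l} {r} l-r≈e e≈0 = begin
    l               ≈⟨ +-identityʳ l ⟨
    l + 0#          ≈⟨ +-congˡ (-‿inverseˡ r) ⟨
    l + (- r + r)   ≈⟨ +-assoc _ _ _ ⟨
    (l - r) + r     ≈⟨ +-congʳ (trans l-r≈e e≈0) ⟩
    0# + r          ≈⟨ +-identityˡ r ⟩
    r               ∎

  inv : ∀ a → ¬ a ≈ 0# → Carrier
  inv a a≉0 = proj₁ (inverse a a≉0)

  1-a*inv≈0 : ∀ a (a≉0 : ¬ a ≈ 0#) → 1# - a * inv a a≉0 ≈ 0#
  1-a*inv≈0 a a≉0 = ≈⇒-≈0 (sym (proj₂ (inverse a a≉0)))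

  a*b≈0⇒b≈0 : ∀ {a b} → ¬ a ≈ 0# → a * b ≈ 0# → b ≈ 0#
  a*b≈0⇒b≈0 {a} {b} a≉0 ab≈0 = ≈-by-certificate
    (solve 3 (λ a b a⁻¹ → b :- :0 := b :* (:1 :- a :* a⁻¹) :+ a⁻¹ :* (a :* b)) refl a b (inv a a≉0))
    (≈0-+ (≈0-*ˡ b (1-a*inv≈0 a a≉0)) (≈0-*ˡ _ ab≈0))

  *-≉0 : ∀ {a b} → ¬ a ≈ 0# → ¬ b ≈ 0# → ¬ a * b ≈ 0#
  *-≉0 a≉0 b≉0 ab≈0 = b≉0 (a*b≈0⇒b≈0 a≉0 ab≈0)

  inv-≉0 : ∀ a (a≉0 : ¬ a ≈ 0#) → ¬ inv a a≉0 ≈ 0#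
  inv-≉0 a a≉0 inv≈0 = 1≉0 (trans (sym (proj₂ (inverse a a≉0))) (≈0-*ˡ a inv≈0))

  ∼-sym : ∀ {u v} → u ∼ v → v ∼ u
  ∼-sym {u} {v} (a , a≉0 , u≈av) = inv a a≉0 , inv-≉0 a a≉0 , λ i → ≈-by-certificate
    (solve 4 (λ v u a a⁻¹ → v :- a⁻¹ :* u := v :* (:1 :- a :* a⁻¹) :+ a⁻¹ :* (a :* v :- u))
      refl (v i) (u i) a (inv a a≉0))
    (≈0-+ (≈0-*ˡ (v i) (1-a*inv≈0 a a≉0)) (≈0-*ˡ _ (≈⇒-≈0 (sym (u≈av i)))))

  ∼-trans : ∀ {u v w} → u ∼ v → v ∼ w → u ∼ w
  ∼-trans (a , a≉0 , u≈av) (b , b≉0 , v≈bw) = a * b , *-≉0 a≉0 b≉0 , λ i →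
    trans (u≈av i) (trans (*-congˡ (v≈bw i)) (sym (*-assoc a b _)))

  i₀ i₁ i₂ i₃ i₄ i₅ : Fin 6
  i₀ = Fin.zero
  i₁ = Fin.suc Fin.zero
  i₂ = Fin.suc (Fin.suc Fin.zero)
  i₃ = Fin.suc (Fin.suc (Fin.suc Fin.zero))
  i₄ = Fin.suc (Fin.suc (Fin.suc (Fin.suc Fin.zero)))
  i₅ = Fin.suc (Fin.suc (Fin.suc (Fin.suc (Fin.suc Fin.zero))))

  comb₃ : Carrier → Carrier → Carrier → Vec6 → Vec6 → Vec6 → Vec6
  comb₃ a b c u v w = ((a · u) ⊕ (b · v)) ⊕ (c · w)

  B : Vec6 → Vec6 → Carrier
  B u v = ((u i₀ * v i₁ + u i₁ * v i₀) + (u i₂ * v i₃ + u i₃ * v i₂)) + (u i₄ * v i₅ + u i₅ * v i₄)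

  Q-cong : ∀ {u v} → u ≈v v → Q u ≈ Q v
  Q-cong u≈v = +-cong (*-cong (u≈v i₀) (u≈v i₁))
                 (+-cong (*-cong (u≈v i₂) (u≈v i₃)) (*-cong (u≈v i₄) (u≈v i₅)))

  B-congˡ : ∀ {u u′} → u ≈v u′ → ∀ v → B u v ≈ B u′ v
  B-congˡ e v = +-cong (+-cong (+-cong (*-congʳ (e i₀)) (*-congʳ (e i₁)))
                               (+-cong (*-congʳ (e i₂)) (*-congʳ (e i₃))))
                       (+-cong (*-congʳ (e i₄)) (*-congʳ (e i₅)))

  Q-⊕ : ∀ u v → Q (u ⊕ v) ≈ (Q u + Q v) + B u v
  Q-⊕ u v = solve 12 (λ u₀ u₁ u₂ u₃ u₄ u₅ v₀ v₁ v₂ v₃ v₄ v₅ →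
      (u₀ :+ v₀) :* (u₁ :+ v₁) :+ ((u₂ :+ v₂) :* (u₃ :+ v₃) :+ (u₄ :+ v₄) :* (u₅ :+ v₅))
    := ((u₀ :* u₁ :+ (u₂ :* u₃ :+ u₄ :* u₅)) :+ (v₀ :* v₁ :+ (v₂ :* v₃ :+ v₄ :* v₅)))
       :+ (((u₀ :* v₁ :+ u₁ :* v₀) :+ (u₂ :* v₃ :+ u₃ :* v₂)) :+ (u₄ :* v₅ :+ u₅ :* v₄)))
    refl (u i₀) (u i₁) (u i₂) (u i₃) (u i₄) (u i₅) (v i₀) (v i₁) (v i₂) (v i₃) (v i₄) (v i₅)

  Q-comb₃ : ∀ a b c u v w → Q (comb₃ a b c u v w) ≈
    ((a * a * Q u + b * b * Q v) + c * c * Q w) + ((a * b * B u v + a * c * B u w) + b * c * B v w)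
  Q-comb₃ a b c u v w = solve 21 (λ a b c u₀ u₁ u₂ u₃ u₄ u₅ v₀ v₁ v₂ v₃ v₄ v₅ w₀ w₁ w₂ w₃ w₄ w₅ →
      ((a :* u₀ :+ b :* v₀) :+ c :* w₀) :* ((a :* u₁ :+ b :* v₁) :+ c :* w₁)
      :+ (((a :* u₂ :+ b :* v₂) :+ c :* w₂) :* ((a :* u₃ :+ b :* v₃) :+ c :* w₃)
        :+ ((a :* u₄ :+ b :* v₄) :+ c :* w₄) :* ((a :* u₅ :+ b :* v₅) :+ c :* w₅))
    := ((a :* a :* (u₀ :* u₁ :+ (u₂ :* u₃ :+ u₄ :* u₅)) :+ b :* b :* (v₀ :* v₁ :+ (v₂ :* v₃ :+ v₄ :* v₅)))
         :+ c :* c :* (w₀ :* w₁ :+ (w₂ :* w₃ :+ w₄ :* w₅)))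
       :+ ((a :* b :* (((u₀ :* v₁ :+ u₁ :* v₀) :+ (u₂ :* v₃ :+ u₃ :* v₂)) :+ (u₄ :* v₅ :+ u₅ :* v₄))
           :+ a :* c :* (((u₀ :* w₁ :+ u₁ :* w₀) :+ (u₂ :* w₃ :+ u₃ :* w₂)) :+ (u₄ :* w₅ :+ u₅ :* w₄)))
           :+ b :* c :* (((v₀ :* w₁ :+ v₁ :* w₀) :+ (v₂ :* w₃ :+ v₃ :* w₂)) :+ (v₄ :* w₅ :+ v₅ :* w₄))))
    refl a b c (u i₀) (u i₁) (u i₂) (u i₃) (u i₄) (u i₅) (v i₀) (v i₁) (v i₂) (v i₃) (v i₄) (v i₅)
      (w i₀) (w i₁) (w i₂) (w i₃) (w i₄) (w i₅)

  B-comb₃ʳ : ∀ y a b c u v w → B y (comb₃ a b c u v w) ≈ (a * B y u + b * B y v) + c * B y w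
  B-comb₃ʳ y a b c u v w = solve 27
    (λ a b c y₀ y₁ y₂ y₃ y₄ y₅ u₀ u₁ u₂ u₃ u₄ u₅ v₀ v₁ v₂ v₃ v₄ v₅ w₀ w₁ w₂ w₃ w₄ w₅ →
      ((y₀ :* ((a :* u₁ :+ b :* v₁) :+ c :* w₁) :+ y₁ :* ((a :* u₀ :+ b :* v₀) :+ c :* w₀))
       :+ (y₂ :* ((a :* u₃ :+ b :* v₃) :+ c :* w₃) :+ y₃ :* ((a :* u₂ :+ b :* v₂) :+ c :* w₂)))
       :+ (y₄ :* ((a :* u₅ :+ b :* v₅) :+ c :* w₅) :+ y₅ :* ((a :* u₄ :+ b :* v₄) :+ c :* w₄))
    := (a :* (((y₀ :* u₁ :+ y₁ :* u₀) :+ (y₂ :* u₃ :+ y₃ :* u₂)) :+ (y₄ :* u₅ :+ y₅ :* u₄))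
        :+ b :* (((y₀ :* v₁ :+ y₁ :* v₀) :+ (y₂ :* v₃ :+ y₃ :* v₂)) :+ (y₄ :* v₅ :+ y₅ :* v₄)))
        :+ c :* (((y₀ :* w₁ :+ y₁ :* w₀) :+ (y₂ :* w₃ :+ y₃ :* w₂)) :+ (y₄ :* w₅ :+ y₅ :* w₄)))
    refl a b c (y i₀) (y i₁) (y i₂) (y i₃) (y i₄) (y i₅) (u i₀) (u i₁) (u i₂) (u i₃) (u i₄) (u i₅)
      (v i₀) (v i₁) (v i₂) (v i₃) (v i₄) (v i₅) (w i₀) (w i₁) (w i₂) (w i₃) (w i₄) (w i₅)

  singular-sum⇒B≈0 : ∀ {u v} → Q u ≈ 0# → Q v ≈ 0# → Q (u ⊕ v) ≈ 0# → B u v ≈ 0#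
  singular-sum⇒B≈0 {u} {v} Qu≈0 Qv≈0 Qu+v≈0 = begin
    B u v                 ≈⟨ +-identityˡ _ ⟨
    0# + B u v            ≈⟨ +-congʳ (≈0-+ Qu≈0 Qv≈0) ⟨
    (Q u + Q v) + B u v   ≈⟨ Q-⊕ u v ⟨
    Q (u ⊕ v)             ≈⟨ Qu+v≈0 ⟩
    0#                    ∎

  span-totallySingular : ∀ {u v w} → Q u ≈ 0# → Q v ≈ 0# → Q w ≈ 0# →
    B u v ≈ 0# → B u w ≈ 0# → B v w ≈ 0# → ∀ a b c → Q (comb₃ a b c u v w) ≈ 0#
  span-totallySingular {u} {v} {w} Qu Qv Qw Buv Buw Bvw a b c = trans (Q-comb₃ a b c u v w)
    (≈0-+ (≈0-+ (≈0-+ (≈0-*ˡ (a * a) Qu) (≈0-*ˡ (b * b) Qv)) (≈0-*ˡ (c * c) Qw))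
          (≈0-+ (≈0-+ (≈0-*ˡ (a * b) Buv) (≈0-*ˡ (a * c) Buw)) (≈0-*ˡ (b * c) Bvw)))

  lineOnQuadric⇒singular : ∀ {x y} → LineOnQuadric x y → Q x ≈ 0# × Q y ≈ 0# × B x y ≈ 0#
  lineOnQuadric⇒singular {x} {y} (_ , singular) = Qx , Qy , singular-sum⇒B≈0 {x} {y} Qx Qy Qx+y
    where
    Qx : Q x ≈ 0#
    Qx = trans (Q-cong {x} λ i → solve 2 (λ x y → x := :1 :* x :+ :0 :* y) refl (x i) (y i)) (singular 1# 0#)
    Qy : Q y ≈ 0#
    Qy = trans (Q-cong {y} λ i → solve 2 (λ x y → y := :0 :* x :+ :1 :* y) refl (x i) (y i)) (singular 0# 1#)
    Qx+y : Q (x ⊕ y) ≈ 0#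
    Qx+y = trans (Q-cong {x ⊕ y} λ i → solve 2 (λ x y → x :+ y := :1 :* x :+ :1 :* y) refl (x i) (y i)) (singular 1# 1#)

  independent2⇒nonZeroʳ : ∀ {x y} → Independent2 x y → NonZero y
  independent2⇒nonZeroʳ {x} {y} ind y≈0 = 1≉0 (proj₂ (ind 0# 1# λ i →
    trans (solve 2 (λ x y → :0 :* x :+ :1 :* y := y) refl (x i) (y i)) (y≈0 i)))

  NonZero₃ : Carrier → Carrier → Carrier → Set
  NonZero₃ a b c = ¬ (a ≈ 0# × b ≈ 0# × c ≈ 0#)

  *-annihilates-nonZero₃⇒≈0 : ∀ {a k₁ k₂ k₃} → NonZero₃ k₁ k₂ k₃ →
    a * k₁ ≈ 0# → a * k₂ ≈ 0# → a * k₃ ≈ 0# → a ≈ 0#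
  *-annihilates-nonZero₃⇒≈0 {a} k≉0 ak₁≈0 ak₂≈0 ak₃≈0 with a ≈? 0#
  ... | yes a≈0 = a≈0
  ... | no  a≉0 = ⊥-elim (k≉0 (a*b≈0⇒b≈0 a≉0 ak₁≈0 , a*b≈0⇒b≈0 a≉0 ak₂≈0 , a*b≈0⇒b≈0 a≉0 ak₃≈0))

  det₂ : Carrier → Carrier → Carrier → Carrier → Carrier
  det₂ a b c d = a * d - b * c

  lin₃ : Carrier → Carrier → Carrier → Carrier → Carrier → Carrier → Carrier
  lin₃ a b c p q r = (a * p + b * q) + c * r

  det₃ : Carrier → Carrier → Carrier → Carrier → Carrier → Carrier → Carrier → Carrier → Carrier → Carrier
  det₃ p₁ p₂ p₃ q₁ q₂ q₃ r₁ r₂ r₃ = lin₃ r₁ r₂ r₃ (det₂ p₂ p₃ q₂ q₃) (det₂ p₃ p₁ q₃ q₁) (det₂ p₁ p₂ q₁ q₂)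

  :lin₃ : ∀ {n} → Polynomial n → Polynomial n → Polynomial n → Polynomial n → Polynomial n →
          Polynomial n → Polynomial n
  :lin₃ a b c p q r = (a :* p :+ b :* q) :+ c :* r

  :det₂ : ∀ {n} → Polynomial n → Polynomial n → Polynomial n → Polynomial n → Polynomial n
  :det₂ a b c d = a :* d :- b :* c

  :det₃ : ∀ {n} → Polynomial n → Polynomial n → Polynomial n → Polynomial n → Polynomial n →
          Polynomial n → Polynomial n → Polynomial n → Polynomial n → Polynomial n
  :det₃ p₁ p₂ p₃ q₁ q₂ q₃ r₁ r₂ r₃ =
    :lin₃ r₁ r₂ r₃ (:det₂ p₂ p₃ q₂ q₃) (:det₂ p₃ p₁ q₃ q₁) (:det₂ p₁ p₂ q₁ q₂)

  det₂-≈0ˡ : ∀ {a b} c d → a ≈ 0# → b ≈ 0# → det₂ a b c d ≈ 0#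
  det₂-≈0ˡ c d a≈0 b≈0 = ≈-by-certificate
    (solve 4 (λ a b c d → :det₂ a b c d :- :0 := d :* a :+ (:- c) :* b) refl _ _ c d)
    (≈0-+ (≈0-*ˡ d a≈0) (≈0-*ˡ (- c) b≈0))

  det₂-≈0ʳ : ∀ a b {c d} → c ≈ 0# → d ≈ 0# → det₂ a b c d ≈ 0#
  det₂-≈0ʳ a b c≈0 d≈0 = ≈-by-certificate
    (solve 4 (λ a b c d → :det₂ a b c d :- :0 := a :* d :+ (:- b) :* c) refl a b _ _)
    (≈0-+ (≈0-*ˡ a d≈0) (≈0-*ˡ (- b) c≈0))

  det₂-combˡ : ∀ a c p q r s → det₂ (a * p + c * r) (a * q + c * s) r s ≈ a * det₂ p q r s
  det₂-combˡ = solve 6 (λ a c p q r s →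
    :det₂ (a :* p :+ c :* r) (a :* q :+ c :* s) r s := a :* :det₂ p q r s) refl

  det₂-combʳ : ∀ a c p q r s → det₂ p q (a * p + c * r) (a * q + c * s) ≈ c * det₂ p q r s
  det₂-combʳ = solve 6 (λ a c p q r s →
    :det₂ p q (a :* p :+ c :* r) (a :* q :+ c :* s) := c :* :det₂ p q r s) refl

  -- The cross product of (α₁, α₂, α₃) and (ν₁, ν₂, ν₃) has components
  -- det₂ α₂ α₃ ν₂ ν₃, det₂ α₃ α₁ ν₃ ν₁ and det₂ α₁ α₂ ν₁ ν₂.
  CrossNonZero : Carrier → Carrier → Carrier → Carrier → Carrier → Carrier → Set
  CrossNonZero α₁ α₂ α₃ ν₁ ν₂ ν₃ = NonZero₃ (det₂ α₂ α₃ ν₂ ν₃) (det₂ α₃ α₁ ν₃ ν₁) (det₂ α₁ α₂ ν₁ ν₂)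

  crossNonZero⇒independent : ∀ {α₁ α₂ α₃ ν₁ ν₂ ν₃} a c → CrossNonZero α₁ α₂ α₃ ν₁ ν₂ ν₃ →
    a * α₁ + c * ν₁ ≈ 0# → a * α₂ + c * ν₂ ≈ 0# → a * α₃ + c * ν₃ ≈ 0# → a ≈ 0# × c ≈ 0#
  crossNonZero⇒independent {α₁} {α₂} {α₃} {ν₁} {ν₂} {ν₃} a c α×ν≉0 w₁≈0 w₂≈0 w₃≈0 =
    *-annihilates-nonZero₃⇒≈0 α×ν≉0
      (annihilateˡ α₂ α₃ ν₂ ν₃ w₂≈0 w₃≈0) (annihilateˡ α₃ α₁ ν₃ ν₁ w₃≈0 w₁≈0) (annihilateˡ α₁ α₂ ν₁ ν₂ w₁≈0 w₂≈0) ,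
    *-annihilates-nonZero₃⇒≈0 α×ν≉0
      (annihilateʳ α₂ α₃ ν₂ ν₃ w₂≈0 w₃≈0) (annihilateʳ α₃ α₁ ν₃ ν₁ w₃≈0 w₁≈0) (annihilateʳ α₁ α₂ ν₁ ν₂ w₁≈0 w₂≈0)
    where
    annihilateˡ : ∀ p q r s → a * p + c * r ≈ 0# → a * q + c * s ≈ 0# → a * det₂ p q r s ≈ 0#
    annihilateˡ p q r s u≈0 v≈0 = trans (sym (det₂-combˡ a c p q r s)) (det₂-≈0ˡ r s u≈0 v≈0)
    annihilateʳ : ∀ p q r s → a * p + c * r ≈ 0# → a * q + c * s ≈ 0# → c * det₂ p q r s ≈ 0#
    annihilateʳ p q r s u≈0 v≈0 = trans (sym (det₂-combʳ a c p q r s)) (det₂-≈0ʳ p q u≈0 v≈0)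

  det₃-≈0ʳ : ∀ p₁ p₂ p₃ q₁ q₂ q₃ {r₁ r₂ r₃} → r₁ ≈ 0# → r₂ ≈ 0# → r₃ ≈ 0# →
             det₃ p₁ p₂ p₃ q₁ q₂ q₃ r₁ r₂ r₃ ≈ 0#
  det₃-≈0ʳ p₁ p₂ p₃ q₁ q₂ q₃ r₁≈0 r₂≈0 r₃≈0 =
    ≈0-+ (≈0-+ (≈0-*ʳ _ r₁≈0) (≈0-*ʳ _ r₂≈0)) (≈0-*ʳ _ r₃≈0)

  det₃≉0⇒trivial-solution : ∀ a b c α₁ α₂ α₃ γ₁ γ₂ γ₃ ν₁ ν₂ ν₃ → ¬ det₃ α₁ α₂ α₃ γ₁ γ₂ γ₃ ν₁ ν₂ ν₃ ≈ 0# →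
    lin₃ a b c α₁ γ₁ ν₁ ≈ 0# → lin₃ a b c α₂ γ₂ ν₂ ≈ 0# → lin₃ a b c α₃ γ₃ ν₃ ≈ 0# →
    a ≈ 0# × b ≈ 0# × c ≈ 0#
  det₃≉0⇒trivial-solution a b c α₁ α₂ α₃ γ₁ γ₂ γ₃ ν₁ ν₂ ν₃ D≉0 w₁≈0 w₂≈0 w₃≈0 =
    a*b≈0⇒b≈0 D≉0 (trans (cramer₁ a b c α₁ α₂ α₃ γ₁ γ₂ γ₃ ν₁ ν₂ ν₃) (det₃-≈0ʳ γ₁ γ₂ γ₃ ν₁ ν₂ ν₃ w₁≈0 w₂≈0 w₃≈0)) ,
    a*b≈0⇒b≈0 D≉0 (trans (cramer₂ a b c α₁ α₂ α₃ γ₁ γ₂ γ₃ ν₁ ν₂ ν₃) (det₃-≈0ʳ ν₁ ν₂ ν₃ α₁ α₂ α₃ w₁≈0 w₂≈0 w₃≈0)) ,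
    a*b≈0⇒b≈0 D≉0 (trans (cramer₃ a b c α₁ α₂ α₃ γ₁ γ₂ γ₃ ν₁ ν₂ ν₃) (det₃-≈0ʳ α₁ α₂ α₃ γ₁ γ₂ γ₃ w₁≈0 w₂≈0 w₃≈0))
    where
    cramer₁ : ∀ a b c α₁ α₂ α₃ γ₁ γ₂ γ₃ ν₁ ν₂ ν₃ → det₃ α₁ α₂ α₃ γ₁ γ₂ γ₃ ν₁ ν₂ ν₃ * a ≈
      det₃ γ₁ γ₂ γ₃ ν₁ ν₂ ν₃ (lin₃ a b c α₁ γ₁ ν₁) (lin₃ a b c α₂ γ₂ ν₂) (lin₃ a b c α₃ γ₃ ν₃)
    cramer₁ = solve 12 (λ a b c α₁ α₂ α₃ γ₁ γ₂ γ₃ ν₁ ν₂ ν₃ → :det₃ α₁ α₂ α₃ γ₁ γ₂ γ₃ ν₁ ν₂ ν₃ :* a :=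
      :det₃ γ₁ γ₂ γ₃ ν₁ ν₂ ν₃ (:lin₃ a b c α₁ γ₁ ν₁) (:lin₃ a b c α₂ γ₂ ν₂) (:lin₃ a b c α₃ γ₃ ν₃)) refl

    cramer₂ : ∀ a b c α₁ α₂ α₃ γ₁ γ₂ γ₃ ν₁ ν₂ ν₃ → det₃ α₁ α₂ α₃ γ₁ γ₂ γ₃ ν₁ ν₂ ν₃ * b ≈
      det₃ ν₁ ν₂ ν₃ α₁ α₂ α₃ (lin₃ a b c α₁ γ₁ ν₁) (lin₃ a b c α₂ γ₂ ν₂) (lin₃ a b c α₃ γ₃ ν₃)
    cramer₂ = solve 12 (λ a b c α₁ α₂ α₃ γ₁ γ₂ γ₃ ν₁ ν₂ ν₃ → :det₃ α₁ α₂ α₃ γ₁ γ₂ γ₃ ν₁ ν₂ ν₃ :* b :=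
      :det₃ ν₁ ν₂ ν₃ α₁ α₂ α₃ (:lin₃ a b c α₁ γ₁ ν₁) (:lin₃ a b c α₂ γ₂ ν₂) (:lin₃ a b c α₃ γ₃ ν₃)) refl

    cramer₃ : ∀ a b c α₁ α₂ α₃ γ₁ γ₂ γ₃ ν₁ ν₂ ν₃ → det₃ α₁ α₂ α₃ γ₁ γ₂ γ₃ ν₁ ν₂ ν₃ * c ≈
      det₃ α₁ α₂ α₃ γ₁ γ₂ γ₃ (lin₃ a b c α₁ γ₁ ν₁) (lin₃ a b c α₂ γ₂ ν₂) (lin₃ a b c α₃ γ₃ ν₃)
    cramer₃ = solve 12 (λ a b c α₁ α₂ α₃ γ₁ γ₂ γ₃ ν₁ ν₂ ν₃ → :det₃ α₁ α₂ α₃ γ₁ γ₂ γ₃ ν₁ ν₂ ν₃ :* c :=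
      :det₃ α₁ α₂ α₃ γ₁ γ₂ γ₃ (:lin₃ a b c α₁ γ₁ ν₁) (:lin₃ a b c α₂ γ₂ ν₂) (:lin₃ a b c α₃ γ₃ ν₃)) refl

  module PlaneCoordinates (e₁ e₂ e₃ : Vec6) (independent : Independent3 e₁ e₂ e₃) where

    pt : Carrier → Carrier → Carrier → Vec6
    pt s₁ s₂ s₃ = comb₃ s₁ s₂ s₃ e₁ e₂ e₃

    InSpan : Vec6 → Set
    InSpan y = ∃ λ γ₁ → ∃ λ γ₂ → ∃ λ γ₃ → y ≈v pt γ₁ γ₂ γ₃

    comb₃-pt : ∀ {x y z α₁ α₂ α₃ γ₁ γ₂ γ₃ ν₁ ν₂ ν₃} a b c →
      x ≈v pt α₁ α₂ α₃ → y ≈v pt γ₁ γ₂ γ₃ → z ≈v pt ν₁ ν₂ ν₃ →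
      comb₃ a b c x y z ≈v pt (lin₃ a b c α₁ γ₁ ν₁) (lin₃ a b c α₂ γ₂ ν₂) (lin₃ a b c α₃ γ₃ ν₃)
    comb₃-pt {α₁ = α₁} {α₂} {α₃} {γ₁} {γ₂} {γ₃} {ν₁} {ν₂} {ν₃} a b c hx hy hz i = trans
      (+-cong (+-cong (*-congˡ (hx i)) (*-congˡ (hy i))) (*-congˡ (hz i)))
      (solve 15 (λ a b c α₁ α₂ α₃ γ₁ γ₂ γ₃ ν₁ ν₂ ν₃ u v w →
          :lin₃ a b c (:lin₃ α₁ α₂ α₃ u v w) (:lin₃ γ₁ γ₂ γ₃ u v w) (:lin₃ ν₁ ν₂ ν₃ u v w)
        := :lin₃ (:lin₃ a b c α₁ γ₁ ν₁) (:lin₃ a b c α₂ γ₂ ν₂) (:lin₃ a b c α₃ γ₃ ν₃) u v w)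
        refl a b c α₁ α₂ α₃ γ₁ γ₂ γ₃ ν₁ ν₂ ν₃ (e₁ i) (e₂ i) (e₃ i))

    det₃≉0⇒independent : ∀ {x y z α₁ α₂ α₃ γ₁ γ₂ γ₃ ν₁ ν₂ ν₃} →
      x ≈v pt α₁ α₂ α₃ → y ≈v pt γ₁ γ₂ γ₃ → z ≈v pt ν₁ ν₂ ν₃ →
      ¬ det₃ α₁ α₂ α₃ γ₁ γ₂ γ₃ ν₁ ν₂ ν₃ ≈ 0# → Independent3 x y z
    det₃≉0⇒independent {α₁ = α₁} {α₂} {α₃} {γ₁} {γ₂} {γ₃} {ν₁} {ν₂} {ν₃} hx hy hz D≉0 a b c comb≈0 =
      det₃≉0⇒trivial-solution a b c α₁ α₂ α₃ γ₁ γ₂ γ₃ ν₁ ν₂ ν₃ D≉0 (proj₁ w≈0) (proj₁ (proj₂ w≈0)) (proj₂ (proj₂ w≈0))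
      where
      w≈0 : lin₃ a b c α₁ γ₁ ν₁ ≈ 0# × lin₃ a b c α₂ γ₂ ν₂ ≈ 0# × lin₃ a b c α₃ γ₃ ν₃ ≈ 0#
      w≈0 = independent _ _ _ (λ i → trans (sym (comb₃-pt a b c hx hy hz i)) (comb≈0 i))

    dependency⇒middle-in-span : ∀ {x y z α₁ α₂ α₃ ν₁ ν₂ ν₃} a b c →
      x ≈v pt α₁ α₂ α₃ → z ≈v pt ν₁ ν₂ ν₃ → ¬ b ≈ 0# → comb₃ a b c x y z ≈v zeroV → InSpan y
    dependency⇒middle-in-span {x} {y} {z} {α₁} {α₂} {α₃} {ν₁} {ν₂} {ν₃} a b c hx hz b≉0 comb≈0 =
      γ α₁ ν₁ , γ α₂ ν₂ , γ α₃ ν₃ , λ i → ≈-by-certificate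
        (solve 16 (λ y x z b b⁻¹ a c α₁ α₂ α₃ ν₁ ν₂ ν₃ u v w →
            y :- :lin₃ ((:- b⁻¹) :* (a :* α₁ :+ c :* ν₁)) ((:- b⁻¹) :* (a :* α₂ :+ c :* ν₂))
                       ((:- b⁻¹) :* (a :* α₃ :+ c :* ν₃)) u v w
          := ((y :* (:1 :- b :* b⁻¹) :+ b⁻¹ :* :lin₃ a b c x y z)
              :+ (:- (b⁻¹ :* a)) :* (x :- :lin₃ α₁ α₂ α₃ u v w))
              :+ (:- (b⁻¹ :* c)) :* (z :- :lin₃ ν₁ ν₂ ν₃ u v w))
          refl (y i) (x i) (z i) b b⁻¹ a c α₁ α₂ α₃ ν₁ ν₂ ν₃ (e₁ i) (e₂ i) (e₃ i))
        (≈0-+ (≈0-+ (≈0-+ (≈0-*ˡ (y i) (1-a*inv≈0 b b≉0)) (≈0-*ˡ b⁻¹ (comb≈0 i)))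
                    (≈0-*ˡ _ (≈⇒-≈0 (hx i)))) (≈0-*ˡ _ (≈⇒-≈0 (hz i))))
      where
      b⁻¹ : Carrier
      b⁻¹ = inv b b≉0
      γ : Carrier → Carrier → Carrier
      γ α ν = (- b⁻¹) * (a * α + c * ν)

    dependency⇒coords : ∀ {x y z α₁ α₂ α₃ ν₁ ν₂ ν₃} a b c →
      x ≈v pt α₁ α₂ α₃ → z ≈v pt ν₁ ν₂ ν₃ → b ≈ 0# → comb₃ a b c x y z ≈v zeroV →
      a * α₁ + c * ν₁ ≈ 0# × a * α₂ + c * ν₂ ≈ 0# × a * α₃ + c * ν₃ ≈ 0#
    dependency⇒coords {x} {y} {z} {α₁} {α₂} {α₃} {ν₁} {ν₂} {ν₃} a b c hx hz b≈0 comb≈0 =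
      independent _ _ _ λ i → ≈-by-certificate
        (solve 15 (λ y x z b a c α₁ α₂ α₃ ν₁ ν₂ ν₃ u v w →
            :lin₃ (a :* α₁ :+ c :* ν₁) (a :* α₂ :+ c :* ν₂) (a :* α₃ :+ c :* ν₃) u v w :- :0
          := ((:lin₃ a b c x y z :+ b :* (:- y)) :+ a :* (:lin₃ α₁ α₂ α₃ u v w :- x))
             :+ c :* (:lin₃ ν₁ ν₂ ν₃ u v w :- z))
          refl (y i) (x i) (z i) b a c α₁ α₂ α₃ ν₁ ν₂ ν₃ (e₁ i) (e₂ i) (e₃ i))
        (≈0-+ (≈0-+ (≈0-+ (comb≈0 i) (≈0-*ʳ _ b≈0)) (≈0-*ˡ a (≈⇒-≈0 (sym (hx i)))))
              (≈0-*ˡ c (≈⇒-≈0 (sym (hz i)))))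

    off-plane⇒independent : ∀ {x y z α₁ α₂ α₃ ν₁ ν₂ ν₃} →
      x ≈v pt α₁ α₂ α₃ → z ≈v pt ν₁ ν₂ ν₃ → CrossNonZero α₁ α₂ α₃ ν₁ ν₂ ν₃ → ¬ InSpan y →
      Independent3 x y z
    off-plane⇒independent hx hz α×ν≉0 y∉π a b c comb≈0 with b ≈? 0#
    ... | no b≉0  = ⊥-elim (y∉π (dependency⇒middle-in-span a b c hx hz b≉0 comb≈0))
    ... | yes b≈0 = proj₁ a≈0×c≈0 , b≈0 , proj₂ a≈0×c≈0
      where
      a≈0×c≈0 : a ≈ 0# × c ≈ 0#
      a≈0×c≈0 = let w₁ , w₂ , w₃ = dependency⇒coords a b c hx hz b≈0 comb≈0
                in crossNonZero⇒independent a c α×ν≉0 w₁ w₂ w₃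

  record SingularFrame (x : Vec6) : Set where
    constructor frame
    field
      e₁ e₂ e₃          : Vec6
      basis-independent : Independent3 e₁ e₂ e₃
      totallySingular   : ∀ a b c → Q (comb₃ a b c e₁ e₂ e₃) ≈ 0#
      α₁ α₂ α₃          : Carrier
      coords            : x ≈v comb₃ α₁ α₂ α₃ e₁ e₂ e₃

  planeOfQuadric⇒frame : ∀ {π x} → PlaneOfQuadric π → InPlane π x → SingularFrame x
  planeOfQuadric⇒frame {π} singular (_ , a , b , c , x≈abc) =
    frame (b₁ π) (b₂ π) (b₃ π) (independent π) singular a b c x≈abc

  frame-rotate : ∀ {x} → SingularFrame x → SingularFrame x
  frame-rotate {x} (frame e₁ e₂ e₃ ind singular α₁ α₂ α₃ coords) =
    frame e₂ e₃ e₁ ind′ (λ a b c → trans (Q-cong (rotate a b c)) (singular c a b)) α₂ α₃ α₁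
      (λ i → trans (coords i) (sym (rotate α₂ α₃ α₁ i)))
    where
    rotate : ∀ a b c → comb₃ a b c e₂ e₃ e₁ ≈v comb₃ c a b e₁ e₂ e₃
    rotate a b c i = solve 6 (λ a b c u v w → :lin₃ a b c v w u := :lin₃ c a b u v w)
      refl a b c (e₁ i) (e₂ i) (e₃ i)
    ind′ : Independent3 e₂ e₃ e₁
    ind′ a b c comb≈0 =
      let c≈0 , a≈0 , b≈0 = ind c a b (λ i → trans (sym (rotate a b c i)) (comb≈0 i))
      in a≈0 , b≈0 , c≈0

  frame-α₁≉0 : ∀ {x} → NonZero x → SingularFrame x → Σ (SingularFrame x) λ fr → ¬ SingularFrame.α₁ fr ≈ 0#
  frame-α₁≉0 x≉0 fr with SingularFrame.α₁ fr ≈? 0#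
  ... | no α₁≉0 = fr , α₁≉0
  ... | yes α₁≈0 with SingularFrame.α₂ fr ≈? 0#
  ...   | no α₂≉0 = frame-rotate fr , α₂≉0
  ...   | yes α₂≈0 with SingularFrame.α₃ fr ≈? 0#
  ...     | no α₃≉0 = frame-rotate (frame-rotate fr) , α₃≉0
  ...     | yes α₃≈0 = ⊥-elim (x≉0 λ i → trans (SingularFrame.coords fr i)
                          (≈0-+ (≈0-+ (≈0-*ʳ _ α₁≈0) (≈0-*ʳ _ α₂≈0)) (≈0-*ʳ _ α₃≈0)))

  SingularPlaneThrough : Vec6 → Vec6 → Set
  SingularPlaneThrough x y = ∃ λ z → Independent3 x y z × (∀ a b c → Q (comb₃ a b c x y z) ≈ 0#)

  lin₃-e₂ : ∀ p q r → lin₃ 0# 1# 0# p q r ≈ q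
  lin₃-e₂ = solve 3 (λ p q r → :lin₃ :0 :1 :0 p q r := q) refl

  lin₃-e₃ : ∀ p q r → lin₃ 0# 0# 1# p q r ≈ r
  lin₃-e₃ = solve 3 (λ p q r → :lin₃ :0 :0 :1 p q r := r) refl

  module ThroughSingularLine {x y} (fr : SingularFrame x) (α₁≉0 : ¬ SingularFrame.α₁ fr ≈ 0#)
                             (xy-on-Q : LineOnQuadric x y) (x≁y : ¬ x ∼ y) where
    open SingularFrame fr
    open PlaneCoordinates e₁ e₂ e₃ basis-independent

    B-pt≈0 : ∀ s₁ s₂ s₃ t₁ t₂ t₃ → B (pt s₁ s₂ s₃) (pt t₁ t₂ t₃) ≈ 0#
    B-pt≈0 s₁ s₂ s₃ t₁ t₂ t₃ = singular-sum⇒B≈0 {pt s₁ s₂ s₃} {pt t₁ t₂ t₃}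
      (totallySingular s₁ s₂ s₃) (totallySingular t₁ t₂ t₃)
      (trans (Q-cong λ i → solve 9 (λ s₁ s₂ s₃ t₁ t₂ t₃ u v w →
                 :lin₃ s₁ s₂ s₃ u v w :+ :lin₃ t₁ t₂ t₃ u v w := :lin₃ (s₁ :+ t₁) (s₂ :+ t₂) (s₃ :+ t₃) u v w)
               refl s₁ s₂ s₃ t₁ t₂ t₃ (e₁ i) (e₂ i) (e₃ i))
             (totallySingular (s₁ + t₁) (s₂ + t₂) (s₃ + t₃)))

    β₁ β₂ β₃ : Carrier
    β₁ = B y e₁
    β₂ = B y e₂
    β₃ = B y e₃

    completeBy : ∀ ν₁ ν₂ ν₃ → B y (pt ν₁ ν₂ ν₃) ≈ 0# → Independent3 x y (pt ν₁ ν₂ ν₃) →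
                 SingularPlaneThrough x y
    completeBy ν₁ ν₂ ν₃ Byz≈0 ind = pt ν₁ ν₂ ν₃ , ind ,
      span-totallySingular {x} {y} {pt ν₁ ν₂ ν₃} Qx≈0 Qy≈0 (totallySingular ν₁ ν₂ ν₃) Bxy≈0
        (trans (B-congˡ coords (pt ν₁ ν₂ ν₃)) (B-pt≈0 α₁ α₂ α₃ ν₁ ν₂ ν₃)) Byz≈0
      where
      Qx≈0 : Q x ≈ 0#
      Qx≈0 = proj₁ (lineOnQuadric⇒singular xy-on-Q)
      Qy≈0 : Q y ≈ 0#
      Qy≈0 = proj₁ (proj₂ (lineOnQuadric⇒singular xy-on-Q))
      Bxy≈0 : B x y ≈ 0#
      Bxy≈0 = proj₂ (proj₂ (lineOnQuadric⇒singular xy-on-Q))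

    in-plane-by : ∀ {γ₁ γ₂ γ₃} ν₁ ν₂ ν₃ → y ≈v pt γ₁ γ₂ γ₃ →
      ¬ det₃ α₁ α₂ α₃ γ₁ γ₂ γ₃ ν₁ ν₂ ν₃ ≈ 0# → SingularPlaneThrough x y
    in-plane-by {γ₁} {γ₂} {γ₃} ν₁ ν₂ ν₃ y≈γ D≉0 = completeBy ν₁ ν₂ ν₃
      (trans (B-congˡ y≈γ (pt ν₁ ν₂ ν₃)) (B-pt≈0 γ₁ γ₂ γ₃ ν₁ ν₂ ν₃))
      (det₃≉0⇒independent coords y≈γ (λ i → refl) D≉0)

    -- The two vanishing components of α × γ give γ = (γ₁ / α₁) α.
    in-plane-proportional : ∀ {γ₁ γ₂ γ₃} → y ≈v pt γ₁ γ₂ γ₃ →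
      det₂ α₃ α₁ γ₃ γ₁ ≈ 0# → det₂ α₁ α₂ γ₁ γ₂ ≈ 0# → y ∼ x
    in-plane-proportional {γ₁} {γ₂} {γ₃} y≈γ d₂≈0 d₃≈0 = t , t≉0 , y≈tx
      where
      α₁⁻¹ : Carrier
      α₁⁻¹ = inv α₁ α₁≉0
      t : Carrier
      t = γ₁ * α₁⁻¹
      y≈tx : y ≈v (t · x)
      y≈tx i = ≈-by-certificate
        (solve 12 (λ y x γ₁ γ₂ γ₃ α₁ α₂ α₃ α₁⁻¹ u v w →
            y :- (γ₁ :* α₁⁻¹) :* x
          := ((((y :- :lin₃ γ₁ γ₂ γ₃ u v w) :+ (:- (γ₁ :* α₁⁻¹)) :* (x :- :lin₃ α₁ α₂ α₃ u v w))
              :+ u :* (γ₁ :* (:1 :- α₁ :* α₁⁻¹)))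
              :+ v :* (γ₂ :* (:1 :- α₁ :* α₁⁻¹) :+ α₁⁻¹ :* :det₂ α₁ α₂ γ₁ γ₂))
              :+ w :* (γ₃ :* (:1 :- α₁ :* α₁⁻¹) :+ (:- α₁⁻¹) :* :det₂ α₃ α₁ γ₃ γ₁))
          refl (y i) (x i) γ₁ γ₂ γ₃ α₁ α₂ α₃ α₁⁻¹ (e₁ i) (e₂ i) (e₃ i))
        (≈0-+ (≈0-+ (≈0-+ (≈0-+ (≈⇒-≈0 (y≈γ i)) (≈0-*ˡ _ (≈⇒-≈0 (coords i))))
                          (≈0-*ˡ (e₁ i) (≈0-*ˡ γ₁ (1-a*inv≈0 α₁ α₁≉0))))
                    (≈0-*ˡ (e₂ i) (≈0-+ (≈0-*ˡ γ₂ (1-a*inv≈0 α₁ α₁≉0)) (≈0-*ˡ α₁⁻¹ d₃≈0))))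
              (≈0-*ˡ (e₃ i) (≈0-+ (≈0-*ˡ γ₃ (1-a*inv≈0 α₁ α₁≉0)) (≈0-*ˡ _ d₂≈0))))
      t≉0 : ¬ t ≈ 0#
      t≉0 t≈0 = independent2⇒nonZeroʳ (proj₁ xy-on-Q) λ i → trans (y≈tx i) (≈0-*ʳ (x i) t≈0)

    in-plane : InSpan y → SingularPlaneThrough x y
    in-plane (γ₁ , γ₂ , γ₃ , y≈γ) with det₂ α₃ α₁ γ₃ γ₁ ≈? 0# | det₂ α₁ α₂ γ₁ γ₂ ≈? 0#
    ... | no d₂≉0   | _         = in-plane-by 0# 1# 0# y≈γ λ D≈0 → d₂≉0 (trans (sym (lin₃-e₂ _ _ _)) D≈0)
    ... | yes _     | no d₃≉0   = in-plane-by 0# 0# 1# y≈γ λ D≈0 → d₃≉0 (trans (sym (lin₃-e₃ _ _ _)) D≈0)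
    ... | yes d₂≈0  | yes d₃≈0  = ⊥-elim (x≁y (∼-sym (in-plane-proportional y≈γ d₂≈0 d₃≈0)))

    B-y-pt : ∀ s₁ s₂ s₃ → B y (pt s₁ s₂ s₃) ≈ lin₃ s₁ s₂ s₃ β₁ β₂ β₃
    B-y-pt s₁ s₂ s₃ = B-comb₃ʳ y s₁ s₂ s₃ e₁ e₂ e₃

    off-plane-e₂ : ¬ InSpan y → β₂ ≈ 0# → SingularPlaneThrough x y
    off-plane-e₂ y∉π β₂≈0 = completeBy 0# 1# 0# (trans (B-y-pt 0# 1# 0#) (trans (lin₃-e₂ β₁ β₂ β₃) β₂≈0))
      (off-plane⇒independent coords (λ i → refl) α×e₂≉0 y∉π)
      where
      α×e₂≉0 : CrossNonZero α₁ α₂ α₃ 0# 1# 0#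
      α×e₂≉0 (_ , _ , d₃≈0) = α₁≉0 (trans (solve 2 (λ α₁ α₂ → α₁ := :det₂ α₁ α₂ :0 :1) refl α₁ α₂) d₃≈0)

    -- ν = (0, β₃, -β₂) is orthogonal to (β₁, β₂, β₃), and not proportional to α since α₁ ≉ 0.
    off-plane-generic : ¬ InSpan y → ¬ (β₂ ≈ 0# × β₃ ≈ 0#) → SingularPlaneThrough x y
    off-plane-generic y∉π β≉0 = completeBy 0# β₃ (- β₂)
      (trans (B-y-pt 0# β₃ (- β₂)) (solve 3 (λ β₁ β₂ β₃ → :lin₃ :0 β₃ (:- β₂) β₁ β₂ β₃ := :0) refl β₁ β₂ β₃))
      (off-plane⇒independent coords (λ i → refl) α×ν≉0 y∉π)
      where
      α×ν≉0 : CrossNonZero α₁ α₂ α₃ 0# β₃ (- β₂)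
      α×ν≉0 (_ , d₂≈0 , d₃≈0) = β≉0
        (a*b≈0⇒b≈0 α₁≉0 (trans (solve 3 (λ α₁ α₃ β₂ → α₁ :* β₂ := :det₂ α₃ α₁ (:- β₂) :0) refl α₁ α₃ β₂) d₂≈0) ,
         a*b≈0⇒b≈0 α₁≉0 (trans (solve 3 (λ α₁ α₂ β₃ → α₁ :* β₃ := :det₂ α₁ α₂ :0 β₃) refl α₁ α₂ β₃) d₃≈0))

    off-plane : ¬ InSpan y → SingularPlaneThrough x y
    off-plane y∉π with β₂ ≈? 0# | β₃ ≈? 0#
    ... | yes β₂≈0 | yes _     = off-plane-e₂ y∉π β₂≈0
    ... | no β₂≉0  | _         = off-plane-generic y∉π λ (β₂≈0 , _) → β₂≉0 β₂≈0
    ... | yes _    | no β₃≉0   = off-plane-generic y∉π λ (_ , β₃≈0) → β₃≉0 β₃≈0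

  singularPlaneThrough : ∀ {x y} → NonZero x → SingularFrame x → LineOnQuadric x y → ¬ x ∼ y →
    ¬ ¬ SingularPlaneThrough x y
  singularPlaneThrough x≉0 fr xy-on-Q x≁y ¬plane = ¬¬-excluded-middle λ where
      (yes y∈π) → ¬plane (in-plane y∈π)
      (no  y∉π) → ¬plane (off-plane y∉π)
    where
    open ThroughSingularLine (proj₁ (frame-α₁≉0 x≉0 fr)) (proj₂ (frame-α₁≉0 x≉0 fr)) xy-on-Q x≁y

  module ProjectiveLine {q} (H : HasOrder R q) where
    open HasOrder H

    -- The q + 1 points of PG(1, F): (u : v) is numbered 0 when v ≈ 0 and
    -- 1 + (the enumeration index of u / v) otherwise.
    pointIndex′ : Carrier → (v : Carrier) → Dec (v ≈ 0#) → Fin (suc q)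
    pointIndex′ u v (yes _)   = Fin.zero
    pointIndex′ u v (no v≉0) = Fin.suc (proj₁ (surjective (u * inv v v≉0)))

    pointIndex : Carrier → Carrier → Fin (suc q)
    pointIndex u v = pointIndex′ u v (v ≈? 0#)

    pointIndex-injective : ∀ u v u′ v′ → pointIndex u v ≡ pointIndex u′ v′ → ¬ (u′ ≈ 0# × v′ ≈ 0#) →
      ∃ λ l → u ≈ l * u′ × v ≈ l * v′
    pointIndex-injective u v u′ v′ eq uv′≉0 with v ≈? 0# | v′ ≈? 0#
    pointIndex-injective u v u′ v′ () uv′≉0 | yes _ | no _
    pointIndex-injective u v u′ v′ () uv′≉0 | no _ | yes _
    ... | yes v≈0 | yes v′≈0 = u * u′⁻¹ , ≈-by-certificate
        (solve 3 (λ u u′ u′⁻¹ → u :- (u :* u′⁻¹) :* u′ := u :* (:1 :- u′ :* u′⁻¹)) refl u u′ u′⁻¹)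
        (≈0-*ˡ u (1-a*inv≈0 u′ u′≉0)) ,
      trans v≈0 (sym (≈0-*ˡ (u * u′⁻¹) v′≈0))
      where
      u′≉0 : ¬ u′ ≈ 0#
      u′≉0 u′≈0 = uv′≉0 (u′≈0 , v′≈0)
      u′⁻¹ : Carrier
      u′⁻¹ = inv u′ u′≉0
    ... | no v≉0 | no v′≉0 = v * v′⁻¹ ,
      ≈-by-certificate
        (solve 5 (λ u v u′ v⁻¹ v′⁻¹ → u :- (v :* v′⁻¹) :* u′ := u :* (:1 :- v :* v⁻¹) :+ v :* (u :* v⁻¹ :- u′ :* v′⁻¹))
          refl u v u′ v⁻¹ v′⁻¹)
        (≈0-+ (≈0-*ˡ u (1-a*inv≈0 v v≉0)) (≈0-*ˡ v (≈⇒-≈0 same-ratio))) ,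
      ≈-by-certificate
        (solve 3 (λ v v′ v′⁻¹ → v :- (v :* v′⁻¹) :* v′ := v :* (:1 :- v′ :* v′⁻¹)) refl v v′ v′⁻¹)
        (≈0-*ˡ v (1-a*inv≈0 v′ v′≉0))
      where
      v⁻¹ v′⁻¹ : Carrier
      v⁻¹  = inv v v≉0
      v′⁻¹ = inv v′ v′≉0
      same-ratio : u * v⁻¹ ≈ u′ * v′⁻¹
      same-ratio = trans (sym (proj₂ (surjective (u * v⁻¹))))
        (trans (reflexive (≡.cong enum (Fin.suc-injective eq))) (proj₂ (surjective (u′ * v′⁻¹))))

  x≈comb₃-100 : ∀ x y z → x ≈v comb₃ 1# 0# 0# x y z
  x≈comb₃-100 x y z i = solve 3 (λ x y z → x := :lin₃ :1 :0 :0 x y z) refl (x i) (y i) (z i)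

  y≈comb₃-010 : ∀ x y z → y ≈v comb₃ 0# 1# 0# x y z
  y≈comb₃-010 x y z i = solve 3 (λ x y z → y := :lin₃ :0 :1 :0 x y z) refl (x i) (y i) (z i)

  independent3⇒nonZero₁ : ∀ {x y z} → Independent3 x y z → NonZero x
  independent3⇒nonZero₁ {x} {y} {z} ind x≈0 =
    1≉0 (proj₁ (ind 1# 0# 0# λ i → trans (sym (x≈comb₃-100 x y z i)) (x≈0 i)))

  independent3⇒nonZero₂ : ∀ {x y z} → Independent3 x y z → NonZero y
  independent3⇒nonZero₂ {x} {y} {z} ind y≈0 =
    1≉0 (proj₁ (proj₂ (ind 0# 1# 0# λ i → trans (sym (y≈comb₃-010 x y z i)) (y≈0 i))))

  AllTangentsThrough : (Vec6 → Set) → Vec6 → Set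
  AllTangentsThrough S n = ∀ p → S p → ∀ r → S r → OnLine p n r → r ∼ p

  module TwoKernels {m} (H : HasOrder R (suc m)) {X : Vec6 → Set} (X-closed : ∀ u v → u ∼ v → X u → X v)
                    {x y z} (I : Independent3 x y z)
                    (f : Fin (suc (suc m)) → Vec6) (f∈S : ∀ i → (plane x y z I ∩ X) (f i))
                    (f-injective : ∀ i j → f i ∼ f j → i ≡ j)
                    (noThreeCollinear : ∀ a b c → (plane x y z I ∩ X) a → (plane x y z I ∩ X) b →
                       (plane x y z I ∩ X) c → ¬ a ∼ b → ¬ a ∼ c → ¬ b ∼ c → Independent3 a b c)
                    (x∉S : ¬ (plane x y z I ∩ X) x)
                    (x-kernel : AllTangentsThrough (plane x y z I ∩ X) x)
                    (y-kernel : AllTangentsThrough (plane x y z I ∩ X) y) where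
    q : ℕ
    q = suc m

    π : Plane
    π = plane x y z I

    S : Vec6 → Set
    S = π ∩ X

    cx cy cz : Fin (suc q) → Carrier
    cx i = proj₁ (proj₂ (proj₁ (f∈S i)))
    cy i = proj₁ (proj₂ (proj₂ (proj₁ (f∈S i))))
    cz i = proj₁ (proj₂ (proj₂ (proj₂ (proj₁ (f∈S i)))))

    f≈c : ∀ i → f i ≈v comb₃ (cx i) (cy i) (cz i) x y z
    f≈c i = proj₂ (proj₂ (proj₂ (proj₂ (proj₁ (f∈S i)))))

    f≉0 : ∀ i → NonZero (f i)
    f≉0 i = proj₁ (proj₁ (f∈S i))

    x∉X : ¬ X x
    x∉X x∈X = x∉S ((independent3⇒nonZero₁ I , 1# , 0# , 0# , x≈comb₃-100 x y z) , x∈X)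

    f-distinct : ∀ {i j} → i ≢ j → ¬ f i ∼ f j
    f-distinct i≢j fi∼fj = i≢j (f-injective _ _ fi∼fj)

    -- Either f i ∼ x, impossible as x ∉ X, or x (f i) is the tangent at f i and misses f j.
    at-most-one-on-xy : ∀ {i j} → i ≢ j → cz i ≈ 0# → cz j ≈ 0# → ⊥
    at-most-one-on-xy {i} {j} i≢j czi≈0 czj≈0 with cy i ≈? 0#
    ... | yes cyi≈0 = x∉X (X-closed (f i) x (cx i , cxi≉0 , fi≈x) (proj₂ (f∈S i)))
      where
      fi≈x : ∀ t → f i t ≈ cx i * x t
      fi≈x t = ≈-by-certificate
        (solve 7 (λ r a b c x y z → r :- a :* x := (r :- :lin₃ a b c x y z) :+ (y :* b :+ z :* c))
          refl (f i t) (cx i) (cy i) (cz i) (x t) (y t) (z t))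
        (≈0-+ (≈⇒-≈0 (f≈c i t)) (≈0-+ (≈0-*ˡ (y t) cyi≈0) (≈0-*ˡ (z t) czi≈0)))
      cxi≉0 : ¬ cx i ≈ 0#
      cxi≉0 cxi≈0 = f≉0 i λ t → trans (fi≈x t) (≈0-*ʳ (x t) cxi≈0)
    ... | no cyi≉0 = f-distinct i≢j (∼-sym (x-kernel (f i) (f∈S i) (f j) (f∈S j)
        (s , cx j - cx i * s , λ t → ≈-by-certificate
          (solve 12 (λ r r′ a b c a′ b′ c′ b⁻¹ x y z →
              r′ :- ((b′ :* b⁻¹) :* r :+ (a′ :- a :* (b′ :* b⁻¹)) :* x)
            := (((r′ :- :lin₃ a′ b′ c′ x y z) :+ (:- (b′ :* b⁻¹)) :* (r :- :lin₃ a b c x y z))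
                :+ b′ :* y :* (:1 :- b :* b⁻¹)) :+ (z :* c′ :+ (:- (b′ :* b⁻¹ :* z)) :* c))
            refl (f i t) (f j t) (cx i) (cy i) (cz i) (cx j) (cy j) (cz j) cyi⁻¹ (x t) (y t) (z t))
          (≈0-+ (≈0-+ (≈0-+ (≈⇒-≈0 (f≈c j t)) (≈0-*ˡ _ (≈⇒-≈0 (f≈c i t)))) (≈0-*ˡ _ (1-a*inv≈0 (cy i) cyi≉0)))
                (≈0-+ (≈0-*ˡ (z t) czj≈0) (≈0-*ˡ _ czi≈0))))))
      where
      cyi⁻¹ : Carrier
      cyi⁻¹ = inv (cy i) cyi≉0
      s : Carrier
      s = cy j * cyi⁻¹

    off-xy : ∃ λ k → ¬ cz k ≈ 0#
    off-xy with cz Fin.zero ≈? 0# | cz (Fin.suc Fin.zero) ≈? 0#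
    ... | no cz₀≉0  | _          = Fin.zero , cz₀≉0
    ... | yes _     | no cz₁≉0   = Fin.suc Fin.zero , cz₁≉0
    ... | yes cz₀≈0 | yes cz₁≈0  = ⊥-elim (at-most-one-on-xy (λ ()) cz₀≈0 cz₁≈0)

    module ProjectionFrom (k : Fin (suc q)) (czk≉0 : ¬ cz k ≈ 0#) where
      open ProjectiveLine H

      p : Vec6
      p = f k

      -- Central projection from p onto the line xy: the point r with coordinates
      -- (a, b, c) goes to cz k · r - c · p, with coordinates (projˣ a c, projʸ b c, 0).
      projˣ projʸ : Carrier → Carrier → Carrier
      projˣ a c = cz k * a - c * cx k
      projʸ b c = cz k * b - c * cy k

      projection : ∀ {r} a b c → r ≈v comb₃ a b c x y z →
        ∀ t → cz k * r t - c * p t ≈ projˣ a c * x t + projʸ b c * y t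
      projection {r} a b c r≈abc t = ≈-by-certificate
        (solve 11 (λ r p a b c a₀ b₀ c₀ x y z →
            (c₀ :* r :- c :* p) :- ((c₀ :* a :- c :* a₀) :* x :+ (c₀ :* b :- c :* b₀) :* y)
          := c₀ :* (r :- :lin₃ a b c x y z) :+ (:- c) :* (p :- :lin₃ a₀ b₀ c₀ x y z))
          refl (r t) (p t) a b c (cx k) (cy k) (cz k) (x t) (y t) (z t))
        (≈0-+ (≈0-*ˡ (cz k) (≈⇒-≈0 (r≈abc t))) (≈0-*ˡ _ (≈⇒-≈0 (f≈c k t))))

      same-projection : ∀ {r r′} a b c a′ b′ c′ → r ≈v comb₃ a b c x y z → r′ ≈v comb₃ a′ b′ c′ x y z →
        ∀ l → projˣ a c ≈ l * projˣ a′ c′ → projʸ b c ≈ l * projʸ b′ c′ →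
        ∀ t → cz k * r t - c * p t ≈ l * (cz k * r′ t - c′ * p t)
      same-projection {r} {r′} a b c a′ b′ c′ r≈abc r′≈abc l eqˣ eqʸ t = ≈-by-certificate
        (solve 9 (λ L L′ x y u₁ v₁ u₂ v₂ l →
            L :- l :* L′
          := ((L :- (u₁ :* x :+ v₁ :* y)) :+ x :* (u₁ :- l :* u₂))
             :+ (y :* (v₁ :- l :* v₂) :+ (:- l) :* (L′ :- (u₂ :* x :+ v₂ :* y))))
          refl (cz k * r t - c * p t) (cz k * r′ t - c′ * p t) (x t) (y t)
            (projˣ a c) (projʸ b c) (projˣ a′ c′) (projʸ b′ c′) l)
        (≈0-+ (≈0-+ (≈⇒-≈0 (projection a b c r≈abc t)) (≈0-*ˡ (x t) (≈⇒-≈0 eqˣ)))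
              (≈0-+ (≈0-*ˡ (y t) (≈⇒-≈0 eqʸ)) (≈0-*ˡ _ (≈⇒-≈0 (projection a′ b′ c′ r′≈abc t)))))

      czk⁻¹ : Carrier
      czk⁻¹ = inv (cz k) czk≉0

      ProjectsTo : Carrier → Carrier → Carrier → Carrier → Carrier → Set
      ProjectsTo a b c u v = ∃ λ l → projˣ a c ≈ l * u × projʸ b c ≈ l * v

      oval-vs-kernel : ∀ {w aw bw cw} → AllTangentsThrough S w → w ≈v comb₃ aw bw cw x y z → cw ≈ 0# →
        ∀ {i} → i ≢ k → ProjectsTo (cx i) (cy i) (cz i) (projˣ aw cw) (projʸ bw cw) → ⊥
      oval-vs-kernel {w} {aw} {bw} {cw} w-kernel w≈abc cw≈0 {i} i≢k (l , eqˣ , eqʸ) =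
        f-distinct i≢k (w-kernel p (f∈S k) (f i) (f∈S i) (cz i * czk⁻¹ , l , λ t → ≈-by-certificate
          (solve 8 (λ r p w cᵢ c₀ c₀⁻¹ l cw →
              r :- ((cᵢ :* c₀⁻¹) :* p :+ l :* w)
            := c₀⁻¹ :* ((c₀ :* r :- cᵢ :* p) :- l :* (c₀ :* w :- cw :* p))
               :+ ((:1 :- c₀ :* c₀⁻¹) :* (r :- l :* w) :+ (:- (c₀⁻¹ :* l :* p)) :* cw))
            refl (f i t) (p t) (w t) (cz i) (cz k) czk⁻¹ l cw)
          (≈0-+ (≈0-*ˡ czk⁻¹ (≈⇒-≈0 (same-projection _ _ _ aw bw cw (f≈c i) w≈abc l eqˣ eqʸ t)))
                (≈0-+ (≈0-*ʳ _ (1-a*inv≈0 (cz k) czk≉0)) (≈0-*ˡ _ cw≈0)))))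

      oval-vs-oval : ∀ {i j} → i ≢ k → j ≢ k → i ≢ j →
        ProjectsTo (cx i) (cy i) (cz i) (projˣ (cx j) (cz j)) (projʸ (cy j) (cz j)) → ⊥
      oval-vs-oval {i} {j} i≢k j≢k i≢j (l , eqˣ , eqʸ) = czk≉0 (proj₁
        (noThreeCollinear (f i) (f j) p (f∈S i) (f∈S j) (f∈S k)
          (f-distinct i≢j) (f-distinct i≢k) (f-distinct j≢k)
          (cz k) (- (l * cz k)) (l * cz j - cz i) λ t → trans
            (solve 7 (λ r r′ p c₀ l cᵢ cⱼ →
                :lin₃ c₀ (:- (l :* c₀)) (l :* cⱼ :- cᵢ) r r′ p
              := (c₀ :* r :- cᵢ :* p) :- l :* (c₀ :* r′ :- cⱼ :* p))
              refl (f i t) (f j t) (p t) (cz k) l (cz i) (cz j))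
            (≈⇒-≈0 (same-projection _ _ _ _ _ _ (f≈c i) (f≈c j) l eqˣ eqʸ t))))

      x-vs-y : ProjectsTo 1# 0# 0# (projˣ 0# 0#) (projʸ 1# 0#) → ⊥
      x-vs-y (l , eqˣ , _) = czk≉0 (trans
        (solve 3 (λ c₀ a₀ l → c₀ := (c₀ :* :1 :- :0 :* a₀) :- l :* (c₀ :* :0 :- :0 :* a₀)) refl (cz k) (cx k) l)
        (≈⇒-≈0 eqˣ))

      proj-x≉0 : ¬ (projˣ 1# 0# ≈ 0# × projʸ 0# 0# ≈ 0#)
      proj-x≉0 (u≈0 , _) = czk≉0 (trans (solve 2 (λ c₀ a₀ → c₀ := c₀ :* :1 :- :0 :* a₀) refl (cz k) (cx k)) u≈0)

      proj-y≉0 : ¬ (projˣ 0# 0# ≈ 0# × projʸ 1# 0# ≈ 0#)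
      proj-y≉0 (_ , v≈0) = czk≉0 (trans (solve 2 (λ c₀ b₀ → c₀ := c₀ :* :1 :- :0 :* b₀) refl (cz k) (cy k)) v≈0)

      proj-oval≉0 : ∀ {j} → j ≢ k → ¬ (projˣ (cx j) (cz j) ≈ 0# × projʸ (cy j) (cz j) ≈ 0#)
      proj-oval≉0 {j} j≢k (u≈0 , v≈0) = f-distinct j≢k (s , s≉0 , fj≈sp)
        where
        s : Carrier
        s = cz j * czk⁻¹
        fj≈sp : f j ≈v (s · p)
        fj≈sp t = ≈-by-certificate
          (solve 5 (λ r p cⱼ c₀ c₀⁻¹ → r :- (cⱼ :* c₀⁻¹) :* p := c₀⁻¹ :* (c₀ :* r :- cⱼ :* p) :+ (:1 :- c₀ :* c₀⁻¹) :* r)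
            refl (f j t) (p t) (cz j) (cz k) czk⁻¹)
          (≈0-+ (≈0-*ˡ czk⁻¹ (trans (projection (cx j) (cy j) (cz j) (f≈c j) t)
                                  (≈0-+ (≈0-*ʳ (x t) u≈0) (≈0-*ʳ (y t) v≈0))))
                (≈0-*ʳ (f j t) (1-a*inv≈0 (cz k) czk≉0)))
        s≉0 : ¬ s ≈ 0#
        s≉0 s≈0 = f≉0 j λ t → trans (fj≈sp t) (≈0-*ʳ (p t) s≈0)

      -- x, y and the q oval points other than p, numbered by Fin (2 + q).
      u v : Fin (suc (suc q)) → Carrier
      u Fin.zero                = projˣ 1# 0#
      u (Fin.suc Fin.zero)      = projˣ 0# 0#
      u (Fin.suc (Fin.suc i))   = projˣ (cx (Fin.punchIn k i)) (cz (Fin.punchIn k i))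
      v Fin.zero                = projʸ 0# 0#
      v (Fin.suc Fin.zero)      = projʸ 1# 0#
      v (Fin.suc (Fin.suc i))   = projʸ (cy (Fin.punchIn k i)) (cz (Fin.punchIn k i))

      index : Fin (suc (suc q)) → Fin (suc q)
      index s = pointIndex (u s) (v s)

      index-injective : ∀ s t → s ≢ t → index s ≢ index t
      index-injective Fin.zero Fin.zero s≢t _ = s≢t ≡.refl
      index-injective (Fin.suc Fin.zero) (Fin.suc Fin.zero) s≢t _ = s≢t ≡.refl
      index-injective Fin.zero (Fin.suc Fin.zero) _ eq =
        x-vs-y (pointIndex-injective _ _ _ _ eq proj-y≉0)
      index-injective (Fin.suc Fin.zero) Fin.zero _ eq =
        x-vs-y (pointIndex-injective _ _ _ _ (≡.sym eq) proj-y≉0)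
      index-injective Fin.zero (Fin.suc (Fin.suc j)) _ eq =
        oval-vs-kernel x-kernel (x≈comb₃-100 x y z) refl (Fin.punchInᵢ≢i k j)
          (pointIndex-injective _ _ _ _ (≡.sym eq) proj-x≉0)
      index-injective (Fin.suc (Fin.suc i)) Fin.zero _ eq =
        oval-vs-kernel x-kernel (x≈comb₃-100 x y z) refl (Fin.punchInᵢ≢i k i)
          (pointIndex-injective _ _ _ _ eq proj-x≉0)
      index-injective (Fin.suc Fin.zero) (Fin.suc (Fin.suc j)) _ eq =
        oval-vs-kernel y-kernel (y≈comb₃-010 x y z) refl (Fin.punchInᵢ≢i k j)
          (pointIndex-injective _ _ _ _ (≡.sym eq) proj-y≉0)
      index-injective (Fin.suc (Fin.suc i)) (Fin.suc Fin.zero) _ eq =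
        oval-vs-kernel y-kernel (y≈comb₃-010 x y z) refl (Fin.punchInᵢ≢i k i)
          (pointIndex-injective _ _ _ _ eq proj-y≉0)
      index-injective (Fin.suc (Fin.suc i)) (Fin.suc (Fin.suc j)) s≢t eq =
        oval-vs-oval (Fin.punchInᵢ≢i k i) (Fin.punchInᵢ≢i k j)
          (λ e → s≢t (≡.cong (λ n → Fin.suc (Fin.suc n)) (Fin.punchIn-injective k i j e)))
          (pointIndex-injective _ _ _ _ eq (proj-oval≉0 (Fin.punchInᵢ≢i k j)))

      contradiction : ⊥
      contradiction with Fin.pigeonhole (ℕ.n<1+n (suc q)) index
      ... | s , t , s<t , eq = index-injective s t (Fin.<⇒≢ s<t) eq

    two-kernels⇒⊥ : ⊥
    two-kernels⇒⊥ = ProjectionFrom.contradiction (proj₁ off-xy) (proj₂ off-xy)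

  typeS×typeC⇒⊥ : ∀ {m X π} → TypeS X π → TypeC (suc m) X π → ⊥
  typeS×typeC⇒⊥ (p , _ , all∼p) (_ , (f , f∈S , f-injective , _) , _) with
    f-injective Fin.zero (Fin.suc Fin.zero)
      (∼-trans (all∼p (f Fin.zero) (f∈S Fin.zero)) (∼-sym (all∼p (f (Fin.suc Fin.zero)) (f∈S (Fin.suc Fin.zero)))))
  ... | ()

  module _ {m} (H : HasOrder R (suc m)) (X : Vec6 → Set) (gq : GQSetSC (suc m) X)
           (h₁ : ∀ x → A₁ X x → ∀ π → PlaneOfQuadric π → InPlane π x → TypeS X π)
           (h₂ : ∀ x → A₂ (suc m) X x → ∀ π → PlaneOfQuadric π → InPlane π x →
                 TypeC (suc m) X π × IsKernel π (π ∩ X) x) where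

    plane-through-A : ∀ {x} → A₁ X x ⊎ A₂ (suc m) X x → ∃ λ π → PlaneOfQuadric π × InPlane π x
    plane-through-A (inj₁ (_ , π , singular , _ , x∈π)) = π , singular , x∈π
    plane-through-A (inj₂ (π , singular , _ , x∈π , _)) = π , singular , x∈π

    module WithinSingularPlane {x y z} (I : Independent3 x y z) (singular : PlaneOfQuadric (plane x y z I))
                   (x≁y : ¬ x ∼ y) where
      π : Plane
      π = plane x y z I

      x∈π : InPlane π x
      x∈π = independent3⇒nonZero₁ I , 1# , 0# , 0# , x≈comb₃-100 x y z

      y∈π : InPlane π y
      y∈π = independent3⇒nonZero₂ I , 0# , 1# , 0# , y≈comb₃-010 x y z

      A₁A₁⇒⊥ : A₁ X x → A₁ X y → ⊥
      A₁A₁⇒⊥ x∈A₁ y∈A₁ = let p , _ , all∼p = h₁ x x∈A₁ π singular x∈π in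
        x≁y (∼-trans (all∼p x (x∈π , proj₁ x∈A₁)) (∼-sym (all∼p y (y∈π , proj₁ y∈A₁))))

      A₂A₂⇒⊥ : A₂ (suc m) X x → A₂ (suc m) X y → ⊥
      A₂A₂⇒⊥ x∈A₂ y∈A₂ =
        let (_ , (f , f∈S , f-injective , _) , noThreeCollinear) , (_ , x∉S , x-kernel) = h₂ x x∈A₂ π singular x∈π
            _ , (_ , _ , y-kernel) = h₂ y y∈A₂ π singular y∈π
        in TwoKernels.two-kernels⇒⊥ H (proj₂ (proj₁ gq)) I f f∈S f-injective noThreeCollinear x∉S x-kernel y-kernel

      A-points⇒⊥ : A₁ X x ⊎ A₂ (suc m) X x → A₁ X y ⊎ A₂ (suc m) X y → ⊥
      A-points⇒⊥ (inj₁ x∈A₁) (inj₁ y∈A₁) = A₁A₁⇒⊥ x∈A₁ y∈A₁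
      A-points⇒⊥ (inj₁ x∈A₁) (inj₂ y∈A₂) =
        typeS×typeC⇒⊥ {m} {X} {π} (h₁ x x∈A₁ π singular x∈π) (proj₁ (h₂ y y∈A₂ π singular y∈π))
      A-points⇒⊥ (inj₂ x∈A₂) (inj₁ y∈A₁) =
        typeS×typeC⇒⊥ {m} {X} {π} (h₁ y y∈A₁ π singular y∈π) (proj₁ (h₂ x x∈A₂ π singular x∈π))
      A-points⇒⊥ (inj₂ x∈A₂) (inj₂ y∈A₂) = A₂A₂⇒⊥ x∈A₂ y∈A₂

    A-points-not-collinear : ∀ x y → A₁ X x ⊎ A₂ (suc m) X x → A₁ X y ⊎ A₂ (suc m) X y → ¬ x ∼ y →
      ¬ LineOnQuadric x y
    A-points-not-collinear x y x∈A y∈A x≁y xy-on-Q =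
      let π , singular , x∈π = plane-through-A x∈A in
      singularPlaneThrough (proj₁ x∈π) (planeOfQuadric⇒frame {π} singular x∈π) xy-on-Q x≁y
        λ (z , I , singular′) → WithinSingularPlane.A-points⇒⊥ I singular′ x≁y x∈A y∈A

lemma2p1 : (R : CommutativeRing 0ℓ 0ℓ) → IsField R → (q : ℕ) → HasOrder R q → 2 ∣ q →
    let open Geometry R in
    (X : Vec6 → Set) → GQSetSC q X →
    (∀ x → A₁ X x → ∀ π → PlaneOfQuadric π → InPlane π x → TypeS X π) →
    (∀ x → A₂ q X x → ∀ π → PlaneOfQuadric π → InPlane π x →
       TypeC q X π × IsKernel π (π ∩ X) x) →
    ∀ x y → (A₁ X x ⊎ A₂ q X x) → (A₁ X y ⊎ A₂ q X y) → ¬ (x ∼ y) →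
    ¬ CollinearInQuadric x y
lemma2p1 R F zero    H _ = ⊥-elim (¬HasOrder0 H)
lemma2p1 R F (suc m) H _ = A-points-not-collinear H
  where open FieldGeometry R F (≈-decidable H)
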